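{- Let $G$ and $H$ be two strongly connected digraphs, each of order at least $2$. Then $$\lambda_2(G\Box H)\ge \lambda_2(G)+\lambda_2(H)-1.$$
   Context: All digraphs are finite, without loops or parallel arcs. For a digraph $D$ and $S\subseteq V(D)$, an $S$-strong subgraph is a strongly connected subgraph of $D$ containing all vertices of $S$; $\lambda_S(D)$ is the maximum number of pairwise arc-disjoint $S$-strong subgraphs of $D$; and $\lambda_2(D)=\min\{\lambda_S(D): S\subseteq V(D),\ |S|=2\}$. The Cartesian product $G\Box H$ has vertex set $V(G)\times V(H)$, and $(x,x')(y,y')$ is an arc iff either $xy\in A(G)$ and $x'=y'$, or $x=y$ and $x'y'\in A(H)$. -}

module Defs where

open import Data.Nat using (ℕ; _≤_)
open import Data.Bool using (Bool; true; false; _∧_; _∨_)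
open import Data.Fin using (Fin; remQuot)
open import Data.Fin.Properties using (_≟_)
open import Data.Fin.Subset using (Subset; _∈_; _⊆_; ∣_∣)
open import Data.Product using (Σ; ∃; _×_; _,_)
open import Relation.Binary.PropositionalEquality using (_≡_; _≢_)
open import Relation.Nullary.Decidable using (⌊_⌋)

-- A finite digraph on vertex set Fin order, given by its (Boolean) arc relation.
-- Since arcs form a relation, there are no parallel arcs.
record Digraph : Set where
  field
    order : ℕ
    adj   : Fin order → Fin order → Bool
open Digraph public

Loopless : Digraph → Set
Loopless D = ∀ x → adj D x x ≡ false

data Reach {n : ℕ} (A : Fin n → Fin n → Bool) : Fin n → Fin n → Set where
  here : ∀ {u} → Reach A u u
  step : ∀ {u w v} → A u w ≡ true → Reach A w v → Reach A u v

StronglyConnected : Digraph → Set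
StronglyConnected D = ∀ u v → Reach (adj D) u v

record Subgraph (D : Digraph) : Set where
  field
    verts    : Subset (order D)
    arcs     : Fin (order D) → Fin (order D) → Bool
    arcs-sub : ∀ u v → arcs u v ≡ true → (adj D u v ≡ true) × (u ∈ verts) × (v ∈ verts)
open Subgraph public

IsSStrong : (D : Digraph) → Subset (order D) → Subgraph D → Set
IsSStrong D S F = (S ⊆ verts F) × (∀ u v → u ∈ verts F → v ∈ verts F → Reach (arcs F) u v)

ArcDisjoint : {D : Digraph} → Subgraph D → Subgraph D → Set
ArcDisjoint F F' = ∀ u v → arcs F u v ≡ true → arcs F' u v ≡ false

Packing : (D : Digraph) → Subset (order D) → ℕ → Set
Packing D S k = Σ (Fin k → Subgraph D) λ F →
  (∀ i → IsSStrong D S (F i)) × (∀ i j → i ≢ j → ArcDisjoint (F i) (F j))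

IsLambdaS : (D : Digraph) → Subset (order D) → ℕ → Set
IsLambdaS D S k = Packing D S k × (∀ m → Packing D S m → m ≤ k)

IsLambda2 : Digraph → ℕ → Set
IsLambda2 D k =
  (∀ S → ∣ S ∣ ≡ 2 → ∃ λ k' → IsLambdaS D S k' × k ≤ k') ×
  (∃ λ S → ∣ S ∣ ≡ 2 × IsLambdaS D S k)

-- Cartesian product; vertex (x , x') of V(G) × V(H) is encoded as combine x x'
-- in Fin (order G * order H), decoded by remQuot.
_□_ : Digraph → Digraph → Digraph
G □ H = record
  { order = order G Data.Nat.* order H
  ; adj   = λ p q → prod (remQuot (order H) p) (remQuot (order H) q)
  }
  where
  prod : Fin (order G) × Fin (order H) → Fin (order G) × Fin (order H) → Bool
  prod (x , x') (y , y') = (adj G x y ∧ ⌊ x' ≟ y' ⌋) ∨ (⌊ x ≟ y ⌋ ∧ adj H x' y')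

module Submission where

-- Choose coordinates with S ⊆ {(x , x'), (y , y')}. In G take a pairwise arc-disjoint strong
-- subgraphs D_i through x and y (they exist because λ_{x,z}(G) ≥ a for some z ≠ x with
-- y ∈ {x , z}), and an arc x → w_i of each D_i; the w_i are distinct and differ from x.
-- Likewise E_j and x' → w'_j in H. For a strong C ⊆ H through x' and y', let F_i be D_i on
-- the layers over x' and y' together with C on the fibre over w_i, and let K_j be all of G
-- on the layer over w'_j together with E_j on the fibres over x and y. Each of them is
-- strong and contains S; the F_i are pairwise arc-disjoint, so are the K_j, and F_i, K_j can
-- only share an arc if w'_j = y', or if w_i = y and C shares an arc with E_j.
-- If w'_j₀ = y' for some j₀, take C = E_j₀ and discard K_j₀; otherwise take C = H and
-- discard F_i₀ if w_i₀ = y, or an arbitrary member. This leaves a + b - 1 members.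

open import Defs
open import Data.Nat using (ℕ; suc; _≤_; _+_; _∸_; _*_; z≤n; s≤s; s≤s⁻¹)
open import Data.Nat.Properties using (≤-trans; ≤-<-trans; ≤⇒≯; m∸n≤m)
open import Data.Bool using (Bool; true; _∧_; _∨_)
open import Data.Bool.Properties using (¬-not; not-¬; ∨-zeroʳ) renaming (_≟_ to _≟ᴮ_)
open import Data.Empty using (⊥)
open import Data.Unit using (⊤; tt)
open import Data.Fin using (Fin; zero; suc; combine; remQuot; splitAt; join; punchIn; inject≤)
open import Data.Fin.Properties
  using (_≟_; any?; remQuot-combine; combine-remQuot; join-splitAt; splitAt-join;
         punchIn-injective; punchInᵢ≢i; inject≤-injective)
open import Data.Fin.Subset using (Subset; _∈_; _⊆_; ∣_∣; ⁅_⁆; _∪_; _-_)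
  renaming (⊤ to all)
open import Data.Fin.Subset.Properties
  using (_∈?_; ∈⊤; nonempty?; Empty-unique; ∣⊥∣≡0; x∈⁅x⁆; x∈⁅y⁆⇒x≡y; ∣⁅x⁆∣≡1;
         ∪-identityˡ; ∪-identityʳ; x∈p∪q⁺; x∈p∪q⁻; x∈p∧x≢y⇒x∈p-y; x∈p⇒∣p-x∣<∣p∣)
open import Data.Product using (∃; ∃₂; _×_; _,_; proj₁; proj₂)
open import Data.Sum using (_⊎_; inj₁; inj₂; [_,_]; [_,_]′)
open import Data.Vec using (tabulate)
open import Data.Vec.Properties using (lookup∘tabulate; []=⇒lookup; lookup⇒[]=)
open import Function using (_∘_)
open import Function.Definitions using (Injective)
open import Relation.Binary.PropositionalEquality
  using (_≡_; _≢_; refl; sym; trans; cong; subst; subst₂; module ≡-Reasoning)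
open import Relation.Nullary using (Dec; yes; no; does; contradiction)
open import Relation.Nullary.Decidable using (⌊_⌋; isYes≗does; dec-true; _×-dec_; _⊎-dec_)

witness : ∀ {A : Set} (a? : Dec A) → does a? ≡ true → A
witness (yes a) _ = a

Reach-trans : ∀ {n} {A : Fin n → Fin n → Bool} {u v w} → Reach A u v → Reach A v w → Reach A u w
Reach-trans here       r′ = r′
Reach-trans (step a r) r′ = step a (Reach-trans r r′)

Reach-map : ∀ {m n} {A : Fin m → Fin m → Bool} {B : Fin n → Fin n → Bool} (f : Fin m → Fin n) →
            (∀ {u v} → A u v ≡ true → B (f u) (f v) ≡ true) →
            ∀ {u v} → Reach A u v → Reach B (f u) (f v)
Reach-map f f-arc here       = here
Reach-map f f-arc (step a r) = step (f-arc a) (Reach-map f f-arc r)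

Reach-out : ∀ {n} {A : Fin n → Fin n → Bool} {u v} → u ≢ v → Reach A u v → ∃ λ w → A u w ≡ true
Reach-out u≢u here       = contradiction refl u≢u
Reach-out _   (step a _) = _ , a

module _ {D : Digraph} where

  Strong : Subgraph D → Set
  Strong F = ∀ u v → u ∈ verts F → v ∈ verts F → Reach (arcs F) u v

  strong-via-hub : (F : Subgraph D) (r : Fin (order D)) →
                   (∀ u → u ∈ verts F → Reach (arcs F) u r × Reach (arcs F) r u) → Strong F
  strong-via-hub F r hub u v u∈F v∈F = Reach-trans (proj₁ (hub u u∈F)) (proj₂ (hub v v∈F))

  Loopless-subgraph : Loopless D → (F : Subgraph D) → ∀ u → arcs F u u ≢ true
  Loopless-subgraph loopless F u a = not-¬ (proj₁ (arcs-sub F u u a)) (loopless u)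

  arcDisjoint : {F F′ : Subgraph D} → (∀ u v → arcs F u v ≡ true → arcs F′ u v ≢ true) →
                ArcDisjoint F F′
  arcDisjoint clash u v a = ¬-not (clash u v a)

  ArcDisjoint-sym : {F F′ : Subgraph D} → ArcDisjoint F F′ → ArcDisjoint F′ F
  ArcDisjoint-sym {F} {F′} disjoint = arcDisjoint {F′} {F} λ u v a′ a → not-¬ a′ (disjoint u v a)

  PairwiseArcDisjoint : {I : Set} → (I → Subgraph D) → Set
  PairwiseArcDisjoint F = ∀ i j → i ≢ j → ArcDisjoint (F i) (F j)

  [,]-disjoint : ∀ {a b} {F : Fin a → Subgraph D} {K : Fin b → Subgraph D}
                 (Ok : Fin a ⊎ Fin b → Set) → PairwiseArcDisjoint F → PairwiseArcDisjoint K →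
                 (∀ i j → Ok (inj₁ i) → Ok (inj₂ j) → ArcDisjoint (F i) (K j)) →
                 ∀ p q → Ok p → Ok q → p ≢ q → ArcDisjoint ([ F , K ]′ p) ([ F , K ]′ q)
  [,]-disjoint _ dF _  _   (inj₁ i) (inj₁ k) _  _   p≢q = dF i k (p≢q ∘ cong inj₁)
  [,]-disjoint _ _  dK _   (inj₂ j) (inj₂ l) _  _   p≢q = dK j l (p≢q ∘ cong inj₂)
  [,]-disjoint _ _  _  dFK (inj₁ i) (inj₂ j) ok ok′ _   = dFK i j ok ok′
  [,]-disjoint {F = F} {K} _ _ _ dFK (inj₂ j) (inj₁ i) ok ok′ _ =
    ArcDisjoint-sym {F i} {K j} (dFK i j ok′ ok)

whole : (D : Digraph) → Subgraph D
whole D = record { verts = all ; arcs = adj D ; arcs-sub = λ _ _ a → a , ∈⊤ , ∈⊤ }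

whole-strong : ∀ {D} → StronglyConnected D → Strong (whole D)
whole-strong connected u v _ _ = connected u v

splitAt-injective : ∀ m {n} → Injective _≡_ _≡_ (splitAt m {n})
splitAt-injective m {n} {i} {j} eq = begin
  i                      ≡⟨ join-splitAt m n i ⟨
  join m n (splitAt m i) ≡⟨ cong (join m n) eq ⟩
  join m n (splitAt m j) ≡⟨ join-splitAt m n j ⟩
  j                      ∎
  where open ≡-Reasoning

module _ {D : Digraph} {S : Subset (order D)} where

  Packing-≤ : ∀ {m n} → m ≤ n → Packing D S n → Packing D S m
  Packing-≤ {m} {n} m≤n (F , strong , disjoint) =
    F ∘ embed , strong ∘ embed ,
    λ k l k≢l → disjoint (embed k) (embed l) (k≢l ∘ inject≤-injective m≤n m≤n k l)
    where
    embed : Fin m → Fin n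
    embed k = inject≤ k m≤n

  Packing-without : ∀ {n} {F : Fin n → Subgraph D} (d : Fin n) → (∀ i → IsSStrong D S (F i)) →
                    (∀ i j → i ≢ d → j ≢ d → i ≢ j → ArcDisjoint (F i) (F j)) →
                    Packing D S (n ∸ 1)
  Packing-without {suc n} {F} d strong disjoint =
    F ∘ punchIn d , strong ∘ punchIn d ,
    λ k l k≢l → disjoint _ _ (punchInᵢ≢i d k) (punchInᵢ≢i d l) (k≢l ∘ punchIn-injective d k l)

  Packing-⊎ : ∀ a b {F : Fin a ⊎ Fin b → Subgraph D} →
              (∀ p → IsSStrong D S (F p)) → PairwiseArcDisjoint F → Packing D S (a + b)
  Packing-⊎ a b {F} strong disjoint =
    F ∘ splitAt a , strong ∘ splitAt a , λ k l k≢l → disjoint _ _ (k≢l ∘ splitAt-injective a)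

  Packing-⊎-without : ∀ a b {F : Fin a ⊎ Fin b → Subgraph D} (d : Fin a ⊎ Fin b) →
                      (∀ p → IsSStrong D S (F p)) →
                      (∀ p q → p ≢ d → q ≢ d → p ≢ q → ArcDisjoint (F p) (F q)) →
                      Packing D S (a + b ∸ 1)
  Packing-⊎-without a b {F} d strong disjoint =
    Packing-without {F = F ∘ splitAt a} (join a b d) (strong ∘ splitAt a)
      λ k l k≢d l≢d k≢l → disjoint _ _ (k≢d ∘ at-d) (l≢d ∘ at-d) (k≢l ∘ splitAt-injective a)
    where
    at-d : ∀ {k} → splitAt a k ≡ d → k ≡ join a b d
    at-d eq = splitAt-injective a (trans eq (sym (splitAt-join a b d)))

x∈⁅y⁆∧x∈⁅z⁆⇒y≡z : ∀ {n} {x y z : Fin n} → x ∈ ⁅ y ⁆ → x ∈ ⁅ z ⁆ → y ≡ z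
x∈⁅y⁆∧x∈⁅z⁆⇒y≡z x∈⁅y⁆ x∈⁅z⁆ = trans (sym (x∈⁅y⁆⇒x≡y _ x∈⁅y⁆)) (x∈⁅y⁆⇒x≡y _ x∈⁅z⁆)

x∈p⇒⁅x⁆⊆p : ∀ {n} {p : Subset n} {x} → x ∈ p → ⁅ x ⁆ ⊆ p
x∈p⇒⁅x⁆⊆p {x = x} x∈p z∈⁅x⁆ = subst (_∈ _) (sym (x∈⁅y⁆⇒x≡y x z∈⁅x⁆)) x∈p

module _ {n : ℕ} {x y : Fin n} where

  x∈⁅x⁆∪⁅y⁆ : x ∈ ⁅ x ⁆ ∪ ⁅ y ⁆
  x∈⁅x⁆∪⁅y⁆ = x∈p∪q⁺ (inj₁ (x∈⁅x⁆ x))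

  y∈⁅x⁆∪⁅y⁆ : y ∈ ⁅ x ⁆ ∪ ⁅ y ⁆
  y∈⁅x⁆∪⁅y⁆ = x∈p∪q⁺ (inj₂ (x∈⁅x⁆ y))

  ∈⁅x⁆∪⁅y⁆⁻ : ∀ {z} → z ∈ ⁅ x ⁆ ∪ ⁅ y ⁆ → z ≡ x ⊎ z ≡ y
  ∈⁅x⁆∪⁅y⁆⁻ z∈ with x∈p∪q⁻ ⁅ x ⁆ ⁅ y ⁆ z∈
  ... | inj₁ z∈⁅x⁆ = inj₁ (x∈⁅y⁆⇒x≡y x z∈⁅x⁆)
  ... | inj₂ z∈⁅y⁆ = inj₂ (x∈⁅y⁆⇒x≡y y z∈⁅y⁆)

  x∈p∧y∈p⇒⁅x⁆∪⁅y⁆⊆p : {p : Subset n} → x ∈ p → y ∈ p → ⁅ x ⁆ ∪ ⁅ y ⁆ ⊆ p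
  x∈p∧y∈p⇒⁅x⁆∪⁅y⁆⊆p x∈p y∈p z∈ with ∈⁅x⁆∪⁅y⁆⁻ z∈
  ... | inj₁ refl = x∈p
  ... | inj₂ refl = y∈p

  ∣p∣≤1⇒x≡y : {p : Subset n} → ∣ p ∣ ≤ 1 → x ∈ p → y ∈ p → x ≡ y
  ∣p∣≤1⇒x≡y {p} ∣p∣≤1 x∈p y∈p with y ≟ x
  ... | yes y≡x = sym y≡x
  ... | no  y≢x = contradiction 2≤∣p∣ (≤⇒≯ ∣p∣≤1)
    where
    2≤∣p∣ : 2 ≤ ∣ p ∣
    2≤∣p∣ = ≤-trans (s≤s (≤-<-trans z≤n (x∈p⇒∣p-x∣<∣p∣ (x∈p∧x≢y⇒x∈p-y y∈p y≢x))))
                    (x∈p⇒∣p-x∣<∣p∣ x∈p)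

∣⁅x⁆∪⁅y⁆∣≡2 : ∀ {n} {x y : Fin n} → x ≢ y → ∣ ⁅ x ⁆ ∪ ⁅ y ⁆ ∣ ≡ 2
∣⁅x⁆∪⁅y⁆∣≡2 {x = zero}  {zero}  x≢y = contradiction refl x≢y
∣⁅x⁆∪⁅y⁆∣≡2 {x = zero}  {suc y} _   = cong suc (trans (cong ∣_∣ (∪-identityˡ ⁅ y ⁆)) (∣⁅x⁆∣≡1 y))
∣⁅x⁆∪⁅y⁆∣≡2 {x = suc x} {zero}  _   = cong suc (trans (cong ∣_∣ (∪-identityʳ ⁅ x ⁆)) (∣⁅x⁆∣≡1 x))
∣⁅x⁆∪⁅y⁆∣≡2 {x = suc x} {suc y} x≢y = ∣⁅x⁆∪⁅y⁆∣≡2 (x≢y ∘ cong suc)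

p-x⊆q⇒p⊆⁅x⁆∪q : ∀ {n} {p q : Subset n} {x} → p - x ⊆ q → p ⊆ ⁅ x ⁆ ∪ q
p-x⊆q⇒p⊆⁅x⁆∪q {x = x} p-x⊆q {z} z∈p with z ≟ x
... | yes refl = x∈p∪q⁺ (inj₁ (x∈⁅x⁆ x))
... | no  z≢x  = x∈p∪q⁺ (inj₂ (p-x⊆q (x∈p∧x≢y⇒x∈p-y z∈p z≢x)))

-- The vertex supplied is only used when p is empty.
∣p∣≤1⇒⊆⁅y⁆ : ∀ {n} {p : Subset n} → ∣ p ∣ ≤ 1 → Fin n → ∃ λ y → p ⊆ ⁅ y ⁆
∣p∣≤1⇒⊆⁅y⁆ {p = p} ∣p∣≤1 default with nonempty? p
... | yes (y , y∈p) = y , λ z∈p → subst (_∈ ⁅ y ⁆) (sym (∣p∣≤1⇒x≡y ∣p∣≤1 z∈p y∈p)) (x∈⁅x⁆ y)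
... | no  p-empty  = default , λ {z} z∈p → contradiction (z , z∈p) p-empty

∣p∣≡2⇒⊆⁅x⁆∪⁅y⁆ : ∀ {n} (p : Subset n) → ∣ p ∣ ≡ 2 → ∃₂ λ x y → p ⊆ ⁅ x ⁆ ∪ ⁅ y ⁆
∣p∣≡2⇒⊆⁅x⁆∪⁅y⁆ {n} p ∣p∣≡2 with nonempty? p
... | no p-empty = contradiction ∣p∣≡0 λ ()
  where
  ∣p∣≡0 : 2 ≡ 0
  ∣p∣≡0 = trans (sym ∣p∣≡2) (trans (cong ∣_∣ (Empty-unique p-empty)) (∣⊥∣≡0 n))
... | yes (x , x∈p) with ∣p∣≤1⇒⊆⁅y⁆ (s≤s⁻¹ (subst (suc ∣ p - x ∣ ≤_) ∣p∣≡2 (x∈p⇒∣p-x∣<∣p∣ x∈p))) x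
...   | y , p-x⊆⁅y⁆ = x , y , p-x⊆q⇒p⊆⁅x⁆∪q p-x⊆⁅y⁆

record RootedPacking (D : Digraph) (x y : Fin (order D)) (k : ℕ) : Set where
  field
    member   : Fin k → Subgraph D
    strong   : ∀ i → Strong (member i)
    disjoint : PairwiseArcDisjoint member
    x∈member : ∀ i → x ∈ verts (member i)
    y∈member : ∀ i → y ∈ verts (member i)
    out      : Fin k → Fin (order D)
    out-arc  : ∀ i → arcs (member i) x (out i) ≡ true

  out∈member : ∀ i → out i ∈ verts (member i)
  out∈member i = proj₂ (proj₂ (arcs-sub (member i) x (out i) (out-arc i)))

  out-injective : Injective _≡_ _≡_ out
  out-injective {i} {j} outi≡outj with i ≟ j
  ... | yes i≡j = i≡j
  ... | no  i≢j = contradiction (disjoint i j i≢j x (out i) (out-arc i))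
                    (not-¬ (subst (λ w → arcs (member j) x w ≡ true) (sym outi≡outj) (out-arc j)))

  out≢x : Loopless D → ∀ i → out i ≢ x
  out≢x loopless i outi≡x = Loopless-subgraph loopless (member i) x
                              (subst (λ w → arcs (member i) x w ≡ true) outi≡x (out-arc i))

distinct-from : ∀ {n} → 2 ≤ n → (x : Fin n) → ∃ λ z → x ≢ z
distinct-from (s≤s (s≤s _)) zero    = suc zero , λ ()
distinct-from (s≤s (s≤s _)) (suc _) = zero , λ ()

partner : ∀ {n} → 2 ≤ n → (x y : Fin n) → ∃ λ z → x ≢ z × y ∈ ⁅ x ⁆ ∪ ⁅ z ⁆
partner 2≤n x y with y ≟ x
... | yes refl = proj₁ (distinct-from 2≤n x) , proj₂ (distinct-from 2≤n x) , x∈⁅x⁆∪⁅y⁆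
... | no  y≢x  = y , y≢x ∘ sym , y∈⁅x⁆∪⁅y⁆

rootedPacking : ∀ {D k} → 2 ≤ order D → IsLambda2 D k → (x y : Fin (order D)) →
                RootedPacking D x y k
rootedPacking 2≤n (k≤λ , _) x y with partner 2≤n x y
... | z , x≢z , y∈⁅x⁆∪⁅z⁆ with k≤λ (⁅ x ⁆ ∪ ⁅ z ⁆) (∣⁅x⁆∪⁅y⁆∣≡2 x≢z)
...   | _ , (P , _) , k≤ with Packing-≤ k≤ P
...     | F , sstrong , disjoint = record
  { member   = F
  ; strong   = proj₂ ∘ sstrong
  ; disjoint = disjoint
  ; x∈member = λ i → proj₁ (sstrong i) x∈⁅x⁆∪⁅y⁆
  ; y∈member = λ i → proj₁ (sstrong i) y∈⁅x⁆∪⁅z⁆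
  ; out      = proj₁ ∘ first-arc
  ; out-arc  = proj₂ ∘ first-arc
  }
  where
  first-arc : ∀ i → ∃ λ w → arcs (F i) x w ≡ true
  first-arc i = Reach-out x≢z (proj₂ (sstrong i) x z (proj₁ (sstrong i) x∈⁅x⁆∪⁅y⁆)
                                                      (proj₁ (sstrong i) y∈⁅x⁆∪⁅y⁆))

-- The right-hand side is adj (G □ H) evaluated at the coordinates (g , h) and (g' , h').
□-arc : ∀ {G H : Digraph} {g g′ h h′} →
        (adj G g g′ ≡ true × h ≡ h′) ⊎ (g ≡ g′ × adj H h h′ ≡ true) →
        (adj G g g′ ∧ ⌊ h ≟ h′ ⌋) ∨ (⌊ g ≟ g′ ⌋ ∧ adj H h h′) ≡ true
□-arc {h = h} (inj₁ (a , refl)) rewrite a | isYes≗does (h ≟ h) | dec-true (h ≟ h) refl = refl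
□-arc {g = g} (inj₂ (refl , a)) rewrite a | isYes≗does (g ≟ g) | dec-true (g ≟ g) refl = ∨-zeroʳ _

-- cross A T U B is the subgraph (A × T) ∪ (U × B) of G □ H: copies of A on the layers over
-- T and copies of B on the fibres over U.
module Cross {G H : Digraph} (A : Subgraph G) (T : Subset (order H))
             (U : Subset (order G)) (B : Subgraph H) where

  coords : Fin (order G * order H) → Fin (order G) × Fin (order H)
  coords = remQuot (order H)

  InCross : Fin (order G) × Fin (order H) → Set
  InCross (g , h) = (g ∈ verts A × h ∈ T) ⊎ (g ∈ U × h ∈ verts B)

  inCross? : ∀ v → Dec (InCross v)
  inCross? (g , h) = (g ∈? verts A ×-dec h ∈? T) ⊎-dec (g ∈? U ×-dec h ∈? verts B)

  CrossArc : Fin (order G) × Fin (order H) → Fin (order G) × Fin (order H) → Set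
  CrossArc (g , h) (g′ , h′) =
    (arcs A g g′ ≡ true × h ∈ T × h ≡ h′) ⊎ (g ≡ g′ × g ∈ U × arcs B h h′ ≡ true)

  crossArc? : ∀ v w → Dec (CrossArc v w)
  crossArc? (g , h) (g′ , h′) =
    (arcs A g g′ ≟ᴮ true ×-dec h ∈? T ×-dec h ≟ h′) ⊎-dec
    (g ≟ g′ ×-dec g ∈? U ×-dec arcs B h h′ ≟ᴮ true)

  crossVerts : Subset (order G * order H)
  crossVerts = tabulate λ p → does (inCross? (coords p))

  crossArcs : Fin (order G * order H) → Fin (order G * order H) → Bool
  crossArcs p q = does (crossArc? (coords p) (coords q))

  ∈crossVerts⁺ : ∀ p → InCross (coords p) → p ∈ crossVerts
  ∈crossVerts⁺ p v = lookup⇒[]= p crossVerts (trans (lookup∘tabulate _ p) (dec-true (inCross? _) v))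

  ∈crossVerts⁻ : ∀ {p} → p ∈ crossVerts → InCross (coords p)
  ∈crossVerts⁻ {p} p∈ = witness (inCross? _) (trans (sym (lookup∘tabulate _ p)) ([]=⇒lookup p∈))

  combine∈crossVerts : ∀ {g h} → InCross (g , h) → combine g h ∈ crossVerts
  combine∈crossVerts {g} {h} v = ∈crossVerts⁺ _ (subst InCross (sym (remQuot-combine g h)) v)

  crossArc⁻ : ∀ {p q} → crossArcs p q ≡ true → CrossArc (coords p) (coords q)
  crossArc⁻ {p} {q} = witness (crossArc? (coords p) (coords q))

  crossArc⁺ : ∀ {g g′ h h′} → CrossArc (g , h) (g′ , h′) →
              crossArcs (combine g h) (combine g′ h′) ≡ true
  crossArc⁺ {g} {g′} {h} {h′} c = dec-true (crossArc? _ _)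
    (subst₂ CrossArc (sym (remQuot-combine g h)) (sym (remQuot-combine g′ h′)) c)

  crossArc-sub : ∀ p q → crossArcs p q ≡ true →
                 adj (G □ H) p q ≡ true × p ∈ crossVerts × q ∈ crossVerts
  crossArc-sub p q c with crossArc⁻ {p} {q} c
  ... | inj₁ (a , h∈T , h≡h′) with arcs-sub A _ _ a
  ...   | adjG , g∈A , g′∈A =
    □-arc {G} {H} (inj₁ (adjG , h≡h′)) ,
    ∈crossVerts⁺ p (inj₁ (g∈A , h∈T)) , ∈crossVerts⁺ q (inj₁ (g′∈A , subst (_∈ T) h≡h′ h∈T))
  crossArc-sub p q c | inj₂ (g≡g′ , g∈U , b) with arcs-sub B _ _ b
  ...   | adjH , h∈B , h′∈B =
    □-arc {G} {H} (inj₂ (g≡g′ , adjH)) ,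
    ∈crossVerts⁺ p (inj₂ (g∈U , h∈B)) , ∈crossVerts⁺ q (inj₂ (subst (_∈ U) g≡g′ g∈U , h′∈B))

  cross : Subgraph (G □ H)
  cross = record { verts = crossVerts ; arcs = crossArcs ; arcs-sub = crossArc-sub }

  Reach-layer : ∀ {h g g′} → h ∈ T → Reach (arcs A) g g′ →
                Reach crossArcs (combine g h) (combine g′ h)
  Reach-layer {h} h∈T = Reach-map (λ g → combine g h) (λ a → crossArc⁺ (inj₁ (a , h∈T , refl)))

  Reach-fibre : ∀ {g h h′} → g ∈ U → Reach (arcs B) h h′ →
                Reach crossArcs (combine g h) (combine g h′)
  Reach-fibre {g} g∈U = Reach-map (combine g) (λ b → crossArc⁺ (inj₂ (refl , g∈U , b)))

  -- Every vertex reaches and is reached from (g₀ , h₀) through the layer and the fibre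
  -- containing it, using g₀ ∈ U ⊆ A and T ⊆ B.
  cross-strong : Strong A → Strong B → U ⊆ verts A → T ⊆ verts B →
                 ∀ {g₀ h₀} → g₀ ∈ U → h₀ ∈ T → Strong cross
  cross-strong A-strong B-strong U⊆A T⊆B {g₀} {h₀} g₀∈U h₀∈T =
    strong-via-hub cross (combine g₀ h₀) λ p p∈ →
      subst (λ p → Reach crossArcs p hub × Reach crossArcs hub p)
            (combine-remQuot {order G} (order H) p) (via-hub (∈crossVerts⁻ p∈))
    where
    hub : Fin (order G * order H)
    hub = combine g₀ h₀
    g₀∈A : g₀ ∈ verts A
    g₀∈A = U⊆A g₀∈U
    h₀∈B : h₀ ∈ verts B
    h₀∈B = T⊆B h₀∈T
    via-hub : ∀ {g h} → InCross (g , h) →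
              Reach crossArcs (combine g h) hub × Reach crossArcs hub (combine g h)
    via-hub (inj₁ (g∈A , h∈T)) =
      Reach-trans (Reach-layer h∈T (A-strong _ _ g∈A g₀∈A))
                  (Reach-fibre g₀∈U (B-strong _ _ (T⊆B h∈T) h₀∈B)) ,
      Reach-trans (Reach-fibre g₀∈U (B-strong _ _ h₀∈B (T⊆B h∈T)))
                  (Reach-layer h∈T (A-strong _ _ g₀∈A g∈A))
    via-hub (inj₂ (g∈U , h∈B)) =
      Reach-trans (Reach-fibre g∈U (B-strong _ _ h∈B h₀∈B))
                  (Reach-layer h₀∈T (A-strong _ _ (U⊆A g∈U) g₀∈A)) ,
      Reach-trans (Reach-layer h₀∈T (A-strong _ _ g₀∈A (U⊆A g∈U)))
                  (Reach-fibre g∈U (B-strong _ _ h₀∈B h∈B))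

open Cross using (cross)

cross-disjoint :
  ∀ {G H : Digraph} → Loopless G → Loopless H →
  (A : Subgraph G) (T : Subset (order H)) (U : Subset (order G)) (B : Subgraph H)
  (A′ : Subgraph G) (T′ : Subset (order H)) (U′ : Subset (order G)) (B′ : Subgraph H) →
  (∀ {h} → h ∈ T → h ∈ T′ → ArcDisjoint A A′) → (∀ {g} → g ∈ U → g ∈ U′ → ArcDisjoint B B′) →
  ArcDisjoint (cross A T U B) (cross A′ T′ U′ B′)
cross-disjoint lG lH A T U B A′ T′ U′ B′ dA dB =
  arcDisjoint {F = cross A T U B} {cross A′ T′ U′ B′} λ p q c c′ →
    clash (Cross.crossArc⁻ A T U B {p} {q} c) (Cross.crossArc⁻ A′ T′ U′ B′ {p} {q} c′)
  where
  clash : ∀ {g g′ h h′} → Cross.CrossArc A T U B (g , h) (g′ , h′) →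
          Cross.CrossArc A′ T′ U′ B′ (g , h) (g′ , h′) → ⊥
  clash (inj₁ (a , h∈T , _))    (inj₁ (a′ , h∈T′ , _))   = not-¬ a′ (dA h∈T h∈T′ _ _ a)
  clash (inj₁ (a , _ , refl))   (inj₂ (refl , _ , _))    = Loopless-subgraph lG A _ a
  clash (inj₂ (refl , _ , b))   (inj₁ (_ , _ , refl))    = Loopless-subgraph lH B _ b
  clash (inj₂ (_ , g∈U , b))    (inj₂ (_ , g∈U′ , b′))   = not-¬ b′ (dB g∈U g∈U′ _ _ b)

module PackingInProduct
  {G H : Digraph} (lG : Loopless G) (lH : Loopless H)
  (sG : StronglyConnected G) (sH : StronglyConnected H)
  {x y : Fin (order G)} {x′ y′ : Fin (order H)} {a b : ℕ}
  (PG : RootedPacking G x y a) (PH : RootedPacking H x′ y′ b)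
  {S : Subset (order G * order H)} (S⊆ : S ⊆ ⁅ combine x x′ ⁆ ∪ ⁅ combine y y′ ⁆) where

  module PG = RootedPacking PG
  module PH = RootedPacking PH

  module F (C : Subgraph H) (i : Fin a) = Cross (PG.member i) (⁅ x′ ⁆ ∪ ⁅ y′ ⁆) ⁅ PG.out i ⁆ C
  module K (j : Fin b) = Cross (whole G) ⁅ PH.out j ⁆ (⁅ x ⁆ ∪ ⁅ y ⁆) (PH.member j)

  S⊆verts : (X : Subgraph (G □ H)) → combine x x′ ∈ verts X → combine y y′ ∈ verts X → S ⊆ verts X
  S⊆verts X xx′∈X yy′∈X p∈S with ∈⁅x⁆∪⁅y⁆⁻ (S⊆ p∈S)
  ... | inj₁ refl = xx′∈X
  ... | inj₂ refl = yy′∈X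

  F-strong : ∀ {C} → Strong C → x′ ∈ verts C → y′ ∈ verts C →
             ∀ i → IsSStrong (G □ H) S (F.cross C i)
  F-strong {C} C-strong x′∈C y′∈C i =
    S⊆verts (F.cross C i) (F.combine∈crossVerts C i (inj₁ (PG.x∈member i , x∈⁅x⁆∪⁅y⁆)))
                          (F.combine∈crossVerts C i (inj₁ (PG.y∈member i , y∈⁅x⁆∪⁅y⁆))) ,
    F.cross-strong C i (PG.strong i) C-strong (x∈p⇒⁅x⁆⊆p (PG.out∈member i))
      (x∈p∧y∈p⇒⁅x⁆∪⁅y⁆⊆p x′∈C y′∈C) (x∈⁅x⁆ (PG.out i)) x∈⁅x⁆∪⁅y⁆

  K-strong : ∀ j → IsSStrong (G □ H) S (K.cross j)
  K-strong j =
    S⊆verts (K.cross j) (K.combine∈crossVerts j (inj₂ (x∈⁅x⁆∪⁅y⁆ , PH.x∈member j)))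
                        (K.combine∈crossVerts j (inj₂ (y∈⁅x⁆∪⁅y⁆ , PH.y∈member j))) ,
    K.cross-strong j (whole-strong sG) (PH.strong j) (λ _ → ∈⊤)
      (x∈p⇒⁅x⁆⊆p (PH.out∈member j)) x∈⁅x⁆∪⁅y⁆ (x∈⁅x⁆ (PH.out j))

  F-disjoint : ∀ C → PairwiseArcDisjoint (F.cross C)
  F-disjoint C i k i≢k =
    cross-disjoint lG lH (PG.member i) _ ⁅ PG.out i ⁆ C (PG.member k) _ ⁅ PG.out k ⁆ C
      (λ _ _ → PG.disjoint i k i≢k)
      λ g∈ g∈′ → contradiction (PG.out-injective (x∈⁅y⁆∧x∈⁅z⁆⇒y≡z g∈ g∈′)) i≢k

  K-disjoint : PairwiseArcDisjoint K.cross
  K-disjoint j l j≢l =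
    cross-disjoint lG lH (whole G) ⁅ PH.out j ⁆ _ (PH.member j)
                         (whole G) ⁅ PH.out l ⁆ _ (PH.member l)
      (λ h∈ h∈′ → contradiction (PH.out-injective (x∈⁅y⁆∧x∈⁅z⁆⇒y≡z h∈ h∈′)) j≢l)
      λ _ _ → PH.disjoint j l j≢l

  F-K-disjoint : ∀ C i j → PH.out j ≢ y′ → (PG.out i ≡ y → ArcDisjoint C (PH.member j)) →
                 ArcDisjoint (F.cross C i) (K.cross j)
  F-K-disjoint C i j w′≢y′ shared =
    cross-disjoint lG lH (PG.member i) _ ⁅ PG.out i ⁆ C (whole G) ⁅ PH.out j ⁆ _ (PH.member j)
      layers fibres
    where
    layers : ∀ {h} → h ∈ ⁅ x′ ⁆ ∪ ⁅ y′ ⁆ → h ∈ ⁅ PH.out j ⁆ → ArcDisjoint (PG.member i) (whole G)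
    layers h∈ h∈′ with ∈⁅x⁆∪⁅y⁆⁻ h∈ | x∈⁅y⁆⇒x≡y _ h∈′
    ... | inj₁ refl | x′≡w′ = contradiction (sym x′≡w′) (PH.out≢x lH j)
    ... | inj₂ refl | y′≡w′ = contradiction (sym y′≡w′) w′≢y′
    fibres : ∀ {g} → g ∈ ⁅ PG.out i ⁆ → g ∈ ⁅ x ⁆ ∪ ⁅ y ⁆ → ArcDisjoint C (PH.member j)
    fibres g∈ g∈′ with x∈⁅y⁆⇒x≡y _ g∈ | ∈⁅x⁆∪⁅y⁆⁻ g∈′
    ... | refl | inj₁ w≡x = contradiction w≡x (PG.out≢x lG i)
    ... | refl | inj₂ w≡y = shared w≡y

  family : Subgraph H → Fin a ⊎ Fin b → Subgraph (G □ H)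
  family C = [ F.cross C , K.cross ]′

  family-strong : ∀ {C} → Strong C → x′ ∈ verts C → y′ ∈ verts C →
                  ∀ p → IsSStrong (G □ H) S (family C p)
  family-strong {C} C-strong x′∈C y′∈C = [ F-strong {C} C-strong x′∈C y′∈C , K-strong ]

  packing-without-K : ∀ j₀ → PH.out j₀ ≡ y′ → Packing (G □ H) S (a + b ∸ 1)
  packing-without-K j₀ w′j₀≡y′ =
    Packing-⊎-without a b {family C} (inj₂ j₀)
      (family-strong (PH.strong j₀) (PH.x∈member j₀) (PH.y∈member j₀))
      ([,]-disjoint (_≢ inj₂ j₀) (F-disjoint C) K-disjoint λ i j _ j≢j₀ →
        F-K-disjoint C i j
          (λ w′j≡y′ → j≢j₀ (cong inj₂ (PH.out-injective (trans w′j≡y′ (sym w′j₀≡y′)))))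
          (λ _ → PH.disjoint j₀ j (j≢j₀ ∘ cong inj₂ ∘ sym)))
    where
    C : Subgraph H
    C = PH.member j₀

  packing-without-F : (∀ j → PH.out j ≢ y′) → ∀ i₀ → PG.out i₀ ≡ y → Packing (G □ H) S (a + b ∸ 1)
  packing-without-F w′≢y′ i₀ wi₀≡y =
    Packing-⊎-without a b {family (whole H)} (inj₁ i₀)
      (family-strong (whole-strong sH) ∈⊤ ∈⊤)
      ([,]-disjoint (_≢ inj₁ i₀) (F-disjoint (whole H)) K-disjoint λ i j i≢i₀ _ →
        F-K-disjoint (whole H) i j (w′≢y′ j)
          (λ wi≡y → contradiction (cong inj₁ (PG.out-injective (trans wi≡y (sym wi₀≡y)))) i≢i₀))

  packing-all : (∀ j → PH.out j ≢ y′) → (∀ i → PG.out i ≢ y) → Packing (G □ H) S (a + b ∸ 1)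
  packing-all w′≢y′ w≢y =
    Packing-≤ (m∸n≤m (a + b) 1)
      (Packing-⊎ a b {family (whole H)} (family-strong (whole-strong sH) ∈⊤ ∈⊤)
        λ p q → [,]-disjoint (λ _ → ⊤) (F-disjoint (whole H)) K-disjoint
                  (λ i j _ _ → F-K-disjoint (whole H) i j (w′≢y′ j)
                                 (λ wi≡y → contradiction wi≡y (w≢y i)))
                  p q tt tt)

  packing : Packing (G □ H) S (a + b ∸ 1)
  packing with any? (λ j → PH.out j ≟ y′) | any? (λ i → PG.out i ≟ y)
  ... | yes (j₀ , w′j₀≡y′) | _               = packing-without-K j₀ w′j₀≡y′
  ... | no ∄j              | yes (i₀ , wi₀≡y) = packing-without-F (λ j → ∄j ∘ (j ,_)) i₀ wi₀≡y
  ... | no ∄j              | no ∄i            = packing-all (λ j → ∄j ∘ (j ,_)) (λ i → ∄i ∘ (i ,_))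

theorem4p2 : (G H : Digraph) → Loopless G → Loopless H →
    StronglyConnected G → StronglyConnected H →
    2 ≤ order G → 2 ≤ order H →
    (a b c : ℕ) → IsLambda2 G a → IsLambda2 H b → IsLambda2 (G □ H) c →
    a + b ∸ 1 ≤ c
theorem4p2 G H lG lH sG sH 2≤∣G∣ 2≤∣H∣ a b c λ₂G λ₂H (_ , S , ∣S∣≡2 , _ , maximal)
  with ∣p∣≡2⇒⊆⁅x⁆∪⁅y⁆ S ∣S∣≡2
... | u , v , S⊆⁅u⁆∪⁅v⁆ =
  maximal (a + b ∸ 1)
    (PackingInProduct.packing lG lH sG sH (rootedPacking 2≤∣G∣ λ₂G x y)
                                      (rootedPacking 2≤∣H∣ λ₂H x′ y′) S⊆)
  where
  x y : Fin (order G)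
  x = proj₁ (remQuot {order G} (order H) u)
  y = proj₁ (remQuot {order G} (order H) v)
  x′ y′ : Fin (order H)
  x′ = proj₂ (remQuot {order G} (order H) u)
  y′ = proj₂ (remQuot {order G} (order H) v)
  S⊆ : S ⊆ ⁅ combine x x′ ⁆ ∪ ⁅ combine y y′ ⁆
  S⊆ = subst₂ (λ u v → S ⊆ ⁅ u ⁆ ∪ ⁅ v ⁆)
         (sym (combine-remQuot {order G} (order H) u)) (sym (combine-remQuot {order G} (order H) v))
         S⊆⁅u⁆∪⁅v⁆
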